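{- Let $p\ge1$, $q=4$, and for $i\in\{0,\dots,p-1\}$ let $F_i\subseteq E$ be a feasible solution to $(p,3)$-FGC (i.e., every $\emptyset\ne A\subsetneq V$ has $|\delta_{F_i\cap\mathcal{S}}(A)|\ge p$ or $|\delta_{F_i}(A)|\ge p+3$) such that every $\emptyset\ne A\subsetneq V$ with $|\delta_{F_i}(A)|=p+3$ has $|\delta_{F_i\cap\mathcal{S}}(A)|\ge i$. Let $\mathcal{C}_i=\{\emptyset\ne A\subsetneq V : |\delta_{F_i}(A)|=p+3,\ |\delta_{F_i\cap\mathcal{S}}(A)|=i\}$. Then $\mathcal{C}_i$ is uncrossable for every $i\le p-2$. Furthermore, if $p$ is even, then $\mathcal{C}_{p-1}$ is uncrossable.
   Context: $G=(V,E)$ is an undirected (multi)graph whose edges are partitioned into safe edges $\mathcal{S}$ and unsafe edges $\mathcal{U}$; $\delta_F(A)$ denotes the set of edges of $F$ with exactly one endpoint in $A$. A family $\mathcal{C}\subseteq2^V$ is uncrossable if for all $A,B\in\mathcal{C}$, either $A\cup B,A\cap B\in\mathcal{C}$ or $A\setminus B,B\setminus A\in\mathcal{C}$. -}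

module Defs where

open import Data.Nat using (ℕ; _+_; _≤_; _≥_)
open import Data.Bool using (Bool; true; false; if_then_else_; _∧_; _xor_)
open import Data.Fin using (Fin)
open import Data.Fin.Subset using (Subset; Nonempty; ∁; _∩_; _∪_; _─_)
open import Data.Vec using (lookup)
open import Data.List using (map; allFin)
open import Data.Nat.ListAction using (sum)
open import Data.Product using (_×_; proj₁; proj₂)
open import Data.Sum using (_⊎_)

-- An undirected multigraph on vertex set Fin n with m edges (indexed by Fin m);
-- each edge has two endpoints (parallel edges allowed), and the edges are
-- partitioned into safe edges (those in `safe`) and unsafe edges (the rest).
record Graph (n m : ℕ) : Set where
  field
    ends : Fin m → Fin n × Fin n
    safe : Subset m
open Graph public

crosses : ∀ {n m} → Graph n m → Subset n → Fin m → Bool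
crosses G A e = lookup A (proj₁ (ends G e)) xor lookup A (proj₂ (ends G e))

δ : ∀ {n m} → Graph n m → Subset m → Subset n → ℕ
δ G F A = sum (map (λ e → if lookup F e ∧ crosses G A e then 1 else 0) (allFin _))

Proper : ∀ {n} → Subset n → Set
Proper A = Nonempty A × Nonempty (∁ A)

FeasibleFGC : ∀ {n m} → Graph n m → ℕ → ℕ → Subset m → Set
FeasibleFGC G p q F =
  ∀ A → Proper A → (δ G (F ∩ safe G) A ≥ p) ⊎ (δ G F A ≥ p + q)

Cfam : ∀ {n m} → Graph n m → ℕ → Subset m → ℕ → Subset n → Set
Cfam G p F i A = Proper A × (δ G F A ≡ p + 3) × (δ G (F ∩ safe G) A ≡ i)
  where open import Relation.Binary.PropositionalEquality using (_≡_)

Uncrossable : ∀ {n} → (Subset n → Set) → Set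
Uncrossable {n} C = ∀ (A B : Subset n) → C A → C B →
  (C (A ∪ B) × C (A ∩ B)) ⊎ (C (A ─ B) × C (B ─ A))

{-# OPTIONS --safe #-}
-- If A and B do not cross, one of the two alternatives holds trivially, using that the family is
-- closed under complements. If they cross, submodularity and posimodularity of the cut function,
-- for F and for its safe part, show that in each of the pairs {A ∪ B, A ∩ B} and {A ─ B, B ─ A}
-- either both sets are in C_i or one of them is light: its cut has at most p + 2 edges, so by
-- feasibility at least p of them are safe. A light set from each pair would form two adjacent
-- corners X, Y of the Venn diagram with d(X) + d(Y) = d(Z) + 2t for some Z ∈ {A, B}, where t counts
-- the edges between two corners, and likewise for safe edges with some t′ ≤ t. Then
-- 2p − i ≤ 2t′ ≤ p + 1, which is impossible if i ≤ p − 2 and forces the odd value 2t′ = p + 1 if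
-- i = p − 1, impossible for even p. All cut identities are checked edge by edge, by a truth table
-- over the memberships of the two ends of the edge.
module Submission where

open import Algebra.Core using (Op₂)
open import Data.Bool using (Bool; true; false; not; _∧_; _∨_; _xor_; if_then_else_)
open import Data.Bool.Properties using (∧-zeroʳ; ∧-identityʳ; xor-annihilates-not)
open import Data.Empty using (⊥; ⊥-elim)
open import Data.Fin using (Fin; zero; suc)
open import Data.Fin.Subset using (Subset; _∩_; _∪_; _─_; ∁; _∈_; _∉_; _⊆_; Nonempty; Empty; inside; outside)
open import Data.Fin.Subset.Properties
  using (nonempty?; _∈?_; ⊆-antisym; ∩-comm; ∪-comm; p∩q⊆p; q⊆p∪q; p─q⊆p; x∈p∩q⁺; x∈p∩q⁻; x∈p∪q⁺; x∈p∪q⁻;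
         x∈p∧x∉q⇒x∈p─q; x∉p⇒x∈∁p; x∈∁p⇒x∉p; x∉∁p⇒x∈p; x∈p⇒x∉∁p)
open import Data.List using ([]; _∷_; map; allFin)
open import Data.List.Properties using (map-cong)
open import Data.Nat using (ℕ; suc; _+_; _*_; _≤_; _≥_; _≤?_; z≤n)
open import Data.Nat.ListAction using (sum)
open import Data.Nat.Properties
  using (_≟_; ≤-refl; ≤-trans; ≤-antisym; ≤-reflexive; +-mono-≤; +-monoˡ-≤; +-monoʳ-≤; *-monoʳ-≤;
         +-cancelˡ-≤; +-cancelʳ-≤; +-suc; +-comm; +-assoc; +-identityʳ; ≰⇒>; 1+n≰n;
         +-commutativeSemigroup; module ≤-Reasoning)
open import Algebra.Properties.CommutativeSemigroup +-commutativeSemigroup using (interchange)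
open import Data.Nat.Divisibility using (_∣_; ∣m+n∣m⇒∣n; ∣1⇒≡1; m∣m*n)
open import Data.Product using (_×_; _,_; proj₁; proj₂; map₂; swap)
open import Data.Sum using (_⊎_; inj₁; inj₂; [_,_])
open import Data.Vec using (_∷_; lookup; here; there)
open import Data.Vec.Properties using (lookup-zipWith; lookup-map)
open import Function using (id; _∘_)
open import Relation.Binary.Core using (Rel)
open import Relation.Binary.Definitions using (Decidable)
open import Relation.Binary.PropositionalEquality
  using (_≡_; refl; sym; trans; cong; cong₂; subst; module ≡-Reasoning)
open import Relation.Nullary using (Dec; yes; no; ¬_; contradiction)
open import Relation.Nullary.Decidable using (True; toWitness; map′; _×-dec_; decidable-stable)

open import Defs

Bool-∀? : {P : Bool → Set} → (∀ b → Dec (P b)) → Dec (∀ b → P b)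
Bool-∀? P? = map′ (λ (f , t) → λ { false → f ; true → t }) (λ h → h false , h true) (P? false ×-dec P? true)

-- The contribution of one edge to an edge count, as a function of whether the edge lies in the
-- edge set and of the memberships (a₁, b₁) and (a₂, b₂) of its two ends in two vertex sets A and B.
EdgeWeight : Set
EdgeWeight = Bool → Bool → Bool → Bool → Bool → ℕ

Pointwise : Rel ℕ _ → EdgeWeight → EdgeWeight → Set
Pointwise _∼_ w w′ = ∀ f a₁ b₁ a₂ b₂ → w f a₁ b₁ a₂ b₂ ∼ w′ f a₁ b₁ a₂ b₂

pointwise? : {_∼_ : Rel ℕ _} → Decidable _∼_ → ∀ w w′ → Dec (Pointwise _∼_ w w′)
pointwise? _∼?_ w w′ =
  Bool-∀? λ f → Bool-∀? λ a₁ → Bool-∀? λ b₁ → Bool-∀? λ a₂ → Bool-∀? λ b₂ →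
    w f a₁ b₁ a₂ b₂ ∼? w′ f a₁ b₁ a₂ b₂

by-truth-table : {_∼_ : Rel ℕ _} (_∼?_ : Decidable _∼_) {w w′ : EdgeWeight} →
                 {holds : True (pointwise? _∼?_ w w′)} → Pointwise _∼_ w w′
by-truth-table _ {holds = holds} = toWitness holds

⟦_⟧ : Bool → ℕ
⟦ b ⟧ = if b then 1 else 0

_⊕_ : EdgeWeight → EdgeWeight → EdgeWeight
(w ⊕ w′) f a₁ b₁ a₂ b₂ = w f a₁ b₁ a₂ b₂ + w′ f a₁ b₁ a₂ b₂

twice : EdgeWeight → EdgeWeight
twice w = w ⊕ w

-- A region S : Op₂ Bool stands for the vertex set {x | S (x ∈ A) (x ∈ B)}.
crossing : Op₂ Bool → EdgeWeight
crossing S f a₁ b₁ a₂ b₂ = ⟦ f ∧ (S a₁ b₁ xor S a₂ b₂) ⟧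

joining : Op₂ Bool → Op₂ Bool → EdgeWeight
joining S T f a₁ b₁ a₂ b₂ = ⟦ f ∧ (S a₁ b₁ ∧ T a₂ b₂ ∨ T a₁ b₁ ∧ S a₂ b₂) ⟧

inA inB inBoth inEither inNeither onlyA onlyB : Op₂ Bool
inA a _ = a
inB _ b = b
inBoth = _∧_
inEither = _∨_
inNeither a b = not (a ∨ b)
onlyA a b = a ∧ not b
onlyB a b = b ∧ not a

module _ {I : Set} where

  sum-map-cong : {f g : I → ℕ} → (∀ x → f x ≡ g x) → ∀ xs → sum (map f xs) ≡ sum (map g xs)
  sum-map-cong f≗g xs = cong sum (map-cong f≗g xs)

  sum-map-mono : {f g : I → ℕ} → (∀ x → f x ≤ g x) → ∀ xs → sum (map f xs) ≤ sum (map g xs)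
  sum-map-mono f≤g []       = z≤n
  sum-map-mono f≤g (x ∷ xs) = +-mono-≤ (f≤g x) (sum-map-mono f≤g xs)

  sum-map-+ : ∀ (f g : I → ℕ) xs → sum (map (λ x → f x + g x) xs) ≡ sum (map f xs) + sum (map g xs)
  sum-map-+ f g []       = refl
  sum-map-+ f g (x ∷ xs) = trans (cong (f x + g x +_) (sum-map-+ f g xs)) (interchange (f x) (g x) _ _)

lookup-─ : ∀ {n} (p q : Subset n) x → lookup (p ─ q) x ≡ lookup p x ∧ not (lookup q x)
lookup-─ (s ∷ _) (inside  ∷ _) zero    = sym (∧-zeroʳ s)
lookup-─ (s ∷ _) (outside ∷ _) zero    = sym (∧-identityʳ s)
lookup-─ (_ ∷ p) (_       ∷ q) (suc x) = lookup-─ p q x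

x∈p─q⇒x∉q : ∀ {n} {x : Fin n} (p q : Subset n) → x ∈ p ─ q → x ∉ q
x∈p─q⇒x∉q (_ ∷ _) (outside ∷ _) here          ()
x∈p─q⇒x∉q (_ ∷ p) (_       ∷ q) (there x∈p─q) (there x∈q) = x∈p─q⇒x∉q p q x∈p─q x∈q

x∈p─q⇒x∉p∩q : ∀ {n} {x : Fin n} (p q : Subset n) → x ∈ p ─ q → x ∉ p ∩ q
x∈p─q⇒x∉p∩q p q x∈p─q x∈p∩q = x∈p─q⇒x∉q p q x∈p─q (proj₂ (x∈p∩q⁻ p q x∈p∩q))

module _ {n} {p q : Subset n} where

  ⊆⇒∪≡ : p ⊆ q → p ∪ q ≡ q
  ⊆⇒∪≡ p⊆q = ⊆-antisym (λ x∈p∪q → [ p⊆q , id ] (x∈p∪q⁻ p q x∈p∪q)) (q⊆p∪q p q)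

  ⊆⇒∩≡ : p ⊆ q → p ∩ q ≡ p
  ⊆⇒∩≡ p⊆q = ⊆-antisym (p∩q⊆p p q) (λ x∈p → x∈p∩q⁺ (x∈p , p⊆q x∈p))

  ─-empty⇒⊆ : Empty (p ─ q) → p ⊆ q
  ─-empty⇒⊆ p─q=∅ {x} x∈p = decidable-stable (x ∈? q) (λ x∉q → p─q=∅ (x , x∈p∧x∉q⇒x∈p─q x∈p x∉q))

  ∩-empty⇒─≡ : Empty (p ∩ q) → p ─ q ≡ p
  ∩-empty⇒─≡ p∩q=∅ =
    ⊆-antisym (p─q⊆p p q) (λ x∈p → x∈p∧x∉q⇒x∈p─q x∈p (λ x∈q → p∩q=∅ (_ , x∈p∩q⁺ (x∈p , x∈q))))

  ∁∪-empty⇒─≡∁ : Empty (∁ (p ∪ q)) → p ─ q ≡ ∁ q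
  ∁∪-empty⇒─≡∁ ∁p∪q=∅ = ⊆-antisym (λ x∈p─q → x∉p⇒x∈∁p (x∈p─q⇒x∉q p q x∈p─q)) ∁q⊆p─q
    where
    ∁q⊆p─q : ∁ q ⊆ p ─ q
    ∁q⊆p─q x∈∁q with x∈p∪q⁻ p q (x∉∁p⇒x∈p (λ x∈∁p∪q → ∁p∪q=∅ (_ , x∈∁p∪q)))
    ... | inj₁ x∈p = x∈p∧x∉q⇒x∈p─q x∈p (x∈∁p⇒x∉p x∈∁q)
    ... | inj₂ x∈q = ⊥-elim (x∈∁p⇒x∉p x∈∁q x∈q)

Crossing : ∀ {n} → Subset n → Subset n → Set
Crossing A B = Nonempty (A ∩ B) × Nonempty (A ─ B) × Nonempty (B ─ A) × Nonempty (∁ (A ∪ B))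

uncrossable-from-crossing-pairs : ∀ {n} {C : Subset n → Set} → (∀ {X} → C X → C (∁ X)) →
  (∀ {A B} → C A → C B → Crossing A B → (C (A ∪ B) × C (A ∩ B)) ⊎ (C (A ─ B) × C (B ─ A))) →
  Uncrossable C
uncrossable-from-crossing-pairs {C = C} C-∁ uncross A B A∈C B∈C
  with nonempty? (A ∩ B) | nonempty? (A ─ B) | nonempty? (B ─ A) | nonempty? (∁ (A ∪ B))
... | no A∩B=∅ | _ | _ | _ =
  inj₂ (subst C (sym (∩-empty⇒─≡ A∩B=∅)) A∈C ,
        subst C (sym (∩-empty⇒─≡ (subst Empty (∩-comm A B) A∩B=∅))) B∈C)
... | _ | no A─B=∅ | _ | _ =
  inj₁ (subst C (sym (⊆⇒∪≡ (─-empty⇒⊆ A─B=∅))) B∈C ,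
        subst C (sym (⊆⇒∩≡ (─-empty⇒⊆ A─B=∅))) A∈C)
... | _ | _ | no B─A=∅ | _ =
  inj₁ (subst C (sym (trans (∪-comm A B) (⊆⇒∪≡ (─-empty⇒⊆ B─A=∅)))) A∈C ,
        subst C (sym (trans (∩-comm A B) (⊆⇒∩≡ (─-empty⇒⊆ B─A=∅)))) B∈C)
... | _ | _ | _ | no ∁A∪B=∅ =
  inj₂ (subst C (sym (∁∪-empty⇒─≡∁ ∁A∪B=∅)) (C-∁ B∈C) ,
        subst C (sym (∁∪-empty⇒─≡∁ (subst (Empty ∘ ∁) (∪-comm A B) ∁A∪B=∅))) (C-∁ A∈C))
... | yes A∩B≠∅ | yes A─B≠∅ | yes B─A≠∅ | yes ∁A∪B≠∅ = uncross A∈C B∈C (A∩B≠∅ , A─B≠∅ , B─A≠∅ , ∁A∪B≠∅)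

proper : ∀ {n} {X Y : Subset n} → Nonempty X → (∀ {x} → x ∈ Y → x ∉ X) → Nonempty Y → Proper X
proper X≠∅ Y∩X=∅ Y≠∅ = X≠∅ , map₂ (λ x∈Y → x∉p⇒x∈∁p (Y∩X=∅ x∈Y)) Y≠∅

crossing-corners-proper : ∀ {n} {A B : Subset n} → Crossing A B →
  Proper (A ∪ B) × Proper (A ∩ B) × Proper (A ─ B) × Proper (B ─ A)
crossing-corners-proper {A = A} {B} (A∩B≠∅ , A─B≠∅ , B─A≠∅ , ∁A∪B≠∅) =
  (map₂ (λ x∈A∩B → x∈p∪q⁺ (inj₁ (proj₁ (x∈p∩q⁻ A B x∈A∩B)))) A∩B≠∅ , ∁A∪B≠∅) ,
  proper A∩B≠∅ (x∈p─q⇒x∉p∩q A B) A─B≠∅ ,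
  proper A─B≠∅ (λ x∈A∩B x∈A─B → x∈p─q⇒x∉p∩q A B x∈A─B x∈A∩B) A∩B≠∅ ,
  proper B─A≠∅ (λ x∈A∩B x∈B─A → x∈p─q⇒x∉p∩q B A x∈B─A (x∈p∩q⁺ (swap (x∈p∩q⁻ A B x∈A∩B)))) A∩B≠∅

δ-∁ : ∀ {n m} (G : Graph n m) F X → δ G F (∁ X) ≡ δ G F X
δ-∁ G F X = sum-map-cong (λ e → cong (λ c → ⟦ lookup F e ∧ c ⟧) (crosses-∁ e)) (allFin _)
  where
  crosses-∁ : ∀ e → crosses G (∁ X) e ≡ crosses G X e
  crosses-∁ e with u , v ← ends G e =
    trans (cong₂ _xor_ (lookup-map u not X) (lookup-map v not X))
          (xor-annihilates-not (lookup X u) (lookup X v))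

Cfam-∁ : ∀ {n m} (G : Graph n m) p F i {X} → Cfam G p F i X → Cfam G p F i (∁ X)
Cfam-∁ G p F i {X} ((X≠∅ , ∁X≠∅) , tight , safe≡i) =
  (∁X≠∅ , map₂ (λ x∈X → x∉p⇒x∈∁p (x∈p⇒x∉∁p x∈X)) X≠∅) ,
  trans (δ-∁ G F X) tight , trans (δ-∁ G (F ∩ safe G) X) safe≡i

module Regions {n m} (G : Graph n m) (A B : Subset n) where

  -- A record rather than a function type, so that the region and the set can be inferred.
  record Represents (S : Op₂ Bool) (X : Subset n) : Set where
    constructor represents
    field lookup-represents : ∀ x → lookup X x ≡ S (lookup A x) (lookup B x)
  open Represents

  represents-A : Represents inA A
  represents-A = represents λ _ → refl

  represents-B : Represents inB B
  represents-B = represents λ _ → refl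

  represents-∩ : Represents inBoth (A ∩ B)
  represents-∩ = represents λ x → lookup-zipWith _∧_ x A B

  represents-∪ : Represents inEither (A ∪ B)
  represents-∪ = represents λ x → lookup-zipWith _∨_ x A B

  represents-─ : Represents onlyA (A ─ B)
  represents-─ = represents (lookup-─ A B)

  represents-─′ : Represents onlyB (B ─ A)
  represents-─′ = represents (lookup-─ B A)

  weight : Subset m → EdgeWeight → Fin m → ℕ
  weight F w e = w (lookup F e) (lookup A u) (lookup B u) (lookup A v) (lookup B v)
    where
    u = proj₁ (ends G e)
    v = proj₂ (ends G e)

  total : Subset m → EdgeWeight → ℕ
  total F w = sum (map (weight F w) (allFin m))

  between : Subset m → Op₂ Bool → Op₂ Bool → ℕ
  between F S T = total F (joining S T)

  total-⊕ : ∀ F w w′ → total F (w ⊕ w′) ≡ total F w + total F w′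
  total-⊕ F w w′ = sum-map-+ (weight F w) (weight F w′) (allFin m)

  total-twice : ∀ F w → total F (twice w) ≡ 2 * total F w
  total-twice F w = trans (total-⊕ F w w) (cong (total F w +_) (sym (+-identityʳ _)))

  total-≡ : ∀ F {w w′} → Pointwise _≡_ w w′ → total F w ≡ total F w′
  total-≡ F w≡w′ = sum-map-cong (λ e → w≡w′ _ _ _ _ _) (allFin m)

  total-≤ : ∀ F {w w′} → Pointwise _≤_ w w′ → total F w ≤ total F w′
  total-≤ F w≤w′ = sum-map-mono (λ e → w≤w′ _ _ _ _ _) (allFin m)

  between-∩-≤ : ∀ F H S T → between (F ∩ H) S T ≤ between F S T
  between-∩-≤ F H S T = sum-map-mono edge (allFin m)
    where
    ⟦∧⟧-mono : ∀ f h b → ⟦ (f ∧ h) ∧ b ⟧ ≤ ⟦ f ∧ b ⟧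
    ⟦∧⟧-mono true  true  _ = ≤-refl
    ⟦∧⟧-mono true  false _ = z≤n
    ⟦∧⟧-mono false _     _ = z≤n
    edge : ∀ e → weight (F ∩ H) (joining S T) e ≤ weight F (joining S T) e
    edge e = subst (λ f → ⟦ f ∧ _ ⟧ ≤ _) (sym (lookup-zipWith _∧_ e F H))
                   (⟦∧⟧-mono (lookup F e) (lookup H e) _)

  δ-represents : ∀ F {S X} → Represents S X → δ G F X ≡ total F (crossing S)
  δ-represents F {S} {X} X≅S = sum-map-cong edge (allFin m)
    where
    edge : ∀ e → ⟦ lookup F e ∧ crosses G X e ⟧ ≡ weight F (crossing S) e
    edge e = cong (λ c → ⟦ lookup F e ∧ c ⟧) (cong₂ _xor_ (lookup-represents X≅S _) (lookup-represents X≅S _))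

  edgewise-δ-≤ : ∀ {S T X Y} → Represents S X → Represents T Y →
                 Pointwise _≤_ (crossing S ⊕ crossing T) (crossing inA ⊕ crossing inB) →
                 ∀ F → δ G F X + δ G F Y ≤ δ G F A + δ G F B
  edgewise-δ-≤ {S} {T} {X} {Y} X≅S Y≅T edgewise F = begin
    δ G F X + δ G F Y                           ≡⟨ cong₂ _+_ (δ-represents F X≅S) (δ-represents F Y≅T) ⟩
    total F (crossing S) + total F (crossing T) ≡⟨ total-⊕ F (crossing S) (crossing T) ⟨
    total F (crossing S ⊕ crossing T)           ≤⟨ total-≤ F edgewise ⟩
    total F (crossing inA ⊕ crossing inB)       ≡⟨ total-⊕ F (crossing inA) (crossing inB) ⟩
    δ G F A + δ G F B                           ∎
    where open ≤-Reasoning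

  edgewise-δ-≡ : ∀ S′ T′ {S T U X Y Z} → Represents S X → Represents T Y → Represents U Z →
                 Pointwise _≡_ (crossing S ⊕ crossing T) (crossing U ⊕ twice (joining S′ T′)) →
                 ∀ F → δ G F X + δ G F Y ≡ δ G F Z + 2 * between F S′ T′
  edgewise-δ-≡ S′ T′ {S} {T} {U} {X} {Y} {Z} X≅S Y≅T Z≅U edgewise F = begin
    δ G F X + δ G F Y
      ≡⟨ cong₂ _+_ (δ-represents F X≅S) (δ-represents F Y≅T) ⟩
    total F (crossing S) + total F (crossing T)
      ≡⟨ total-⊕ F (crossing S) (crossing T) ⟨
    total F (crossing S ⊕ crossing T)
      ≡⟨ total-≡ F edgewise ⟩
    total F (crossing U ⊕ twice (joining S′ T′))
      ≡⟨ total-⊕ F (crossing U) (twice (joining S′ T′)) ⟩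
    total F (crossing U) + total F (twice (joining S′ T′))
      ≡⟨ cong₂ _+_ (δ-represents F Z≅U) (sym (total-twice F (joining S′ T′))) ⟨
    δ G F Z + 2 * between F S′ T′
      ∎
    where open ≡-Reasoning

  δ-submodular : ∀ F → δ G F (A ∪ B) + δ G F (A ∩ B) ≤ δ G F A + δ G F B
  δ-submodular = edgewise-δ-≤ represents-∪ represents-∩ (by-truth-table _≤?_)

  δ-posimodular : ∀ F → δ G F (A ─ B) + δ G F (B ─ A) ≤ δ G F A + δ G F B
  δ-posimodular = edgewise-δ-≤ represents-─ represents-─′ (by-truth-table _≤?_)

  δ-∩-─ : ∀ F → δ G F (A ∩ B) + δ G F (A ─ B) ≡ δ G F A + 2 * between F inBoth onlyA
  δ-∩-─ = edgewise-δ-≡ inBoth onlyA represents-∩ represents-─ represents-A (by-truth-table _≟_)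

  δ-∩-─′ : ∀ F → δ G F (A ∩ B) + δ G F (B ─ A) ≡ δ G F B + 2 * between F inBoth onlyB
  δ-∩-─′ = edgewise-δ-≡ inBoth onlyB represents-∩ represents-─′ represents-B (by-truth-table _≟_)

  δ-∪-─ : ∀ F → δ G F (A ∪ B) + δ G F (A ─ B) ≡ δ G F B + 2 * between F inNeither onlyA
  δ-∪-─ = edgewise-δ-≡ inNeither onlyA represents-∪ represents-─ represents-B (by-truth-table _≟_)

  δ-∪-─′ : ∀ F → δ G F (A ∪ B) + δ G F (B ─ A) ≡ δ G F A + 2 * between F inNeither onlyB
  δ-∪-─′ = edgewise-δ-≡ inNeither onlyB represents-∪ represents-─′ represents-A (by-truth-table _≟_)

squeeze : ∀ {a b k} → k ≤ a → k ≤ b → a + b ≤ k + k → a ≡ k × b ≡ k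
squeeze {a} {b} {k} k≤a k≤b a+b≤k+k =
  ≤-antisym (+-cancelʳ-≤ k a k (≤-trans (+-monoʳ-≤ a k≤b) a+b≤k+k)) k≤a ,
  ≤-antisym (+-cancelˡ-≤ k b k (≤-trans (+-monoˡ-≤ b k≤a) a+b≤k+k)) k≤b

-- 2t would lie in [2p − i, p + 1]: empty if i + 2 ≤ p, and {p + 1}, which is odd, if i + 1 = p.
parity-obstruction : ∀ {p i t} → 2 * t ≤ suc p → p + p ≤ i + 2 * t → ¬ (i + 2 ≤ p ⊎ (2 ∣ p × i + 1 ≡ p))
parity-obstruction {p} {i} {t} 2t≤1+p 2p≤i+2t (inj₁ i+2≤p) = 1+n≰n (begin
  suc (suc i) ≡⟨ +-comm 2 i ⟩
  i + 2       ≤⟨ i+2≤p ⟩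
  p           ≤⟨ p≤1+i ⟩
  suc i       ∎)
  where
  open ≤-Reasoning
  p≤1+i : p ≤ suc i
  p≤1+i = +-cancelʳ-≤ p p (suc i) (begin
    p + p     ≤⟨ 2p≤i+2t ⟩
    i + 2 * t ≤⟨ +-monoʳ-≤ i 2t≤1+p ⟩
    i + suc p ≡⟨ +-suc i p ⟩
    suc i + p ∎)
parity-obstruction {i = i} {t} 2t≤2+i 2p≤i+2t (inj₂ (2∣p , refl)) =
  contradiction (∣1⇒≡1 (∣m+n∣m⇒∣n 2∣p+1 2∣p)) λ ()
  where
  open ≤-Reasoning
  2+i≤2t : suc (i + 1) ≤ 2 * t
  2+i≤2t = +-cancelˡ-≤ i _ _ (begin
    i + suc (i + 1)   ≡⟨ +-assoc i 1 (i + 1) ⟨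
    (i + 1) + (i + 1) ≤⟨ 2p≤i+2t ⟩
    i + 2 * t         ∎)
  2∣p+1 : 2 ∣ (i + 1) + 1
  2∣p+1 = subst (2 ∣_) (trans (≤-antisym 2t≤2+i 2+i≤2t) (+-comm 1 (i + 1))) (m∣m*n t)

light-pair-impossible : ∀ {p i dX dY sX sY t t′} →
  dX ≤ p + 2 → dY ≤ p + 2 → p ≤ sX → p ≤ sY → t′ ≤ t →
  dX + dY ≡ (p + 3) + 2 * t → sX + sY ≡ i + 2 * t′ →
  ¬ (i + 2 ≤ p ⊎ (2 ∣ p × i + 1 ≡ p))
light-pair-impossible {p} {i} {dX} {dY} {t = t} {t′} dX≤ dY≤ p≤sX p≤sY t′≤t d-sum s-sum =
  parity-obstruction {t = t′} (≤-trans (*-monoʳ-≤ 2 t′≤t) 2t≤1+p)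
                              (≤-trans (+-mono-≤ p≤sX p≤sY) (≤-reflexive s-sum))
  where
  open ≤-Reasoning
  2t≤1+p : 2 * t ≤ suc p
  2t≤1+p = +-cancelˡ-≤ (p + 3) _ _ (begin
    (p + 3) + 2 * t   ≡⟨ d-sum ⟨
    dX + dY           ≤⟨ +-mono-≤ dX≤ dY≤ ⟩
    (p + 2) + (p + 2) ≡⟨ +-assoc p 2 (p + 2) ⟩
    p + (2 + (p + 2)) ≡⟨ cong (λ x → p + (2 + x)) (+-comm p 2) ⟩
    p + (3 + suc p)   ≡⟨ +-assoc p 3 (suc p) ⟨
    (p + 3) + suc p   ∎)

module _ {n m} (G : Graph n m) (p i : ℕ) (F : Subset m)
         (feasible : FeasibleFGC G p 3 F)
         (tight⇒i≤safe : ∀ X → Proper X → δ G F X ≡ p + 3 → δ G (F ∩ safe G) X ≥ i) where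

  private
    C : Subset n → Set
    C = Cfam G p F i

    FS : Subset m
    FS = F ∩ safe G

  Light : Subset n → Set
  Light X = δ G F X ≤ p + 2 × p ≤ δ G FS X

  light-or-heavy : ∀ {X} → Proper X → Light X ⊎ p + 3 ≤ δ G F X
  light-or-heavy {X} X-proper with feasible X X-proper | δ G F X ≤? p + 2
  ... | inj₂ heavy  | _         = inj₂ heavy
  ... | inj₁ p≤safe | yes small = inj₁ (small , p≤safe)
  ... | inj₁ _      | no ¬small = inj₂ (subst (_≤ δ G F X) (sym (+-suc p 2)) (≰⇒> ¬small))

  tight-or-light : ∀ {X Y Z Z′} → C Z → C Z′ → (∀ H → δ G H X + δ G H Y ≤ δ G H Z + δ G H Z′) →
                   Proper X → Proper Y → (C X × C Y) ⊎ (Light X ⊎ Light Y)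
  tight-or-light {X} {Y} (_ , dZ , sZ) (_ , dZ′ , sZ′) δ-≤ X-proper Y-proper
    with light-or-heavy X-proper | light-or-heavy Y-proper
  ... | inj₁ X-light | _            = inj₂ (inj₁ X-light)
  ... | inj₂ _       | inj₁ Y-light = inj₂ (inj₂ Y-light)
  ... | inj₂ X-heavy | inj₂ Y-heavy =
    let dX , dY = squeeze X-heavy Y-heavy (≤-trans (δ-≤ F) (≤-reflexive (cong₂ _+_ dZ dZ′)))
        sX , sY = squeeze (tight⇒i≤safe X X-proper dX) (tight⇒i≤safe Y Y-proper dY)
                          (≤-trans (δ-≤ FS) (≤-reflexive (cong₂ _+_ sZ sZ′)))
    in inj₁ ((X-proper , dX , sX) , (Y-proper , dY , sY))

  module _ (parity : i + 2 ≤ p ⊎ (2 ∣ p × i + 1 ≡ p)) {A B} (A∈C : C A) (B∈C : C B) where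
    open Regions G A B

    adjacent-not-both-light : ∀ X Y {Z} S T → C Z →
      (∀ H → δ G H X + δ G H Y ≡ δ G H Z + 2 * between H S T) → Light X → Light Y → ⊥
    adjacent-not-both-light X Y S T (_ , dZ , sZ) δ-≡ (dX≤ , p≤sX) (dY≤ , p≤sY) =
      light-pair-impossible dX≤ dY≤ p≤sX p≤sY (between-∩-≤ F (safe G) S T)
        (trans (δ-≡ F) (cong (_+ _) dZ)) (trans (δ-≡ FS) (cong (_+ _) sZ)) parity

    corners-not-light : Light (A ∪ B) ⊎ Light (A ∩ B) → Light (A ─ B) ⊎ Light (B ─ A) → ⊥
    corners-not-light (inj₂ ∩-light) (inj₁ ─-light) =
      adjacent-not-both-light (A ∩ B) (A ─ B) inBoth onlyA A∈C δ-∩-─ ∩-light ─-light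
    corners-not-light (inj₂ ∩-light) (inj₂ ─-light) =
      adjacent-not-both-light (A ∩ B) (B ─ A) inBoth onlyB B∈C δ-∩-─′ ∩-light ─-light
    corners-not-light (inj₁ ∪-light) (inj₁ ─-light) =
      adjacent-not-both-light (A ∪ B) (A ─ B) inNeither onlyA B∈C δ-∪-─ ∪-light ─-light
    corners-not-light (inj₁ ∪-light) (inj₂ ─-light) =
      adjacent-not-both-light (A ∪ B) (B ─ A) inNeither onlyB A∈C δ-∪-─′ ∪-light ─-light

    crossing-pair-uncrossed : Crossing A B → (C (A ∪ B) × C (A ∩ B)) ⊎ (C (A ─ B) × C (B ─ A))
    crossing-pair-uncrossed crossing
      with ∪-proper , ∩-proper , ─-proper , ─-proper′ ← crossing-corners-proper crossing
      with tight-or-light A∈C B∈C δ-submodular ∪-proper ∩-proper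
         | tight-or-light A∈C B∈C δ-posimodular ─-proper ─-proper′
    ... | inj₁ tight  | _           = inj₁ tight
    ... | inj₂ _      | inj₁ tight  = inj₂ tight
    ... | inj₂ light  | inj₂ light′ = ⊥-elim (corners-not-light light light′)

lemma3p7 : ∀ {n m} (G : Graph n m) (p : ℕ) → p ≥ 1 →
    (i : ℕ) → (F : Subset m) → FeasibleFGC G p 3 F →
    (∀ A → Proper A → δ G F A ≡ p + 3 → δ G (F ∩ safe G) A ≥ i) →
    (i + 2 ≤ p ⊎ (2 ∣ p × i + 1 ≡ p)) →
    Uncrossable (Cfam G p F i)
lemma3p7 G p _ i F feasible tight⇒i≤safe parity =
  uncrossable-from-crossing-pairs (Cfam-∁ G p F i)
    (crossing-pair-uncrossed G p i F feasible tight⇒i≤safe parity)
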